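{- Let $r\ge 2$, $k$ and $n$ be integers with $n\ge 108(r+1)^r k$ and $k\ge f(r)$, where $f(r)=2r+1$ if $r=2$ and $f(r)=3r+4$ if $r\ge 3$. Let $G$ be a graph on $n$ vertices containing no cycle of length $2k+1$ as a subgraph, with $\delta(G)\ge \frac{n}{2r+2}$. Then for any even path $P_{xy}$ in $G$ with end vertices $x,y$ and at most $2k$ vertices, we have $|(N(x)\cap N(y))\setminus V(P_{xy})|\le 15r$.
   Context: $\delta(G)$ is the minimum degree and $N(v)$ the set of neighbours of $v$ in $G$. A path is called even (odd) if its number of vertices is even (odd); the order of a path is its number of vertices. $P_{xy}$ denotes a path with end vertices $x$ and $y$. -}

module Defs where

open import Data.Nat using (ℕ; zero; suc; _+_; _*_; _≤_)
open import Data.Fin using (Fin; zero; suc; toℕ; fromℕ; inject₁)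
open import Data.Fin.Subset using (Subset; ∣_∣; _∩_; _─_)
open import Data.Vec using (tabulate)
open import Data.Fin.Properties using (any?) renaming (_≟_ to _≟ᶠ_)
open import Data.Product using (Σ; _×_)
open import Data.Empty using (⊥)
open import Relation.Nullary using (¬_; Dec; does)
open import Function.Definitions using (Injective)
open import Relation.Binary.PropositionalEquality using (_≡_)

record Graph (n : ℕ) : Set₁ where
  field
    Adj    : Fin n → Fin n → Set
    adj?   : ∀ u v → Dec (Adj u v)
    sym    : ∀ {u v} → Adj u v → Adj v u
    irrefl : ∀ {u} → ¬ Adj u u

open Graph public

N : ∀ {n} → Graph n → Fin n → Subset n
N G v = tabulate (λ u → does (adj? G v u))

degree : ∀ {n} → Graph n → Fin n → ℕ
degree G v = ∣ N G v ∣

-- A path on suc m vertices: injective sequence p 0, ..., p m with consecutive vertices adjacent.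
-- Its end vertices are p zero and p (fromℕ m).
IsPath : ∀ {n} → Graph n → (m : ℕ) → (Fin (suc m) → Fin n) → Set
IsPath G m p = Injective _≡_ _≡_ p × (∀ (i : Fin m) → Adj G (p (inject₁ i)) (p (suc i)))

HasCycleOfLength : ∀ {n} → Graph n → ℕ → Set
HasCycleOfLength G zero = ⊥
HasCycleOfLength {n} G (suc m) =
  Σ (Fin (suc m) → Fin n) (λ c → IsPath G m c × Adj G (c (fromℕ m)) (c zero))

vertexSet : ∀ {n m} → (Fin m → Fin n) → Subset n
vertexSet p = tabulate (λ v → does (any? (λ i → p i ≟ᶠ v)))

f : ℕ → ℕ
f 2 = 5
f r = 3 * r + 4

{-# OPTIONS --safe #-}
-- Let A be the set of common neighbours of the ends x, y of P that lie off P, and suppose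
-- |A| > 15r, so |A| ≥ 2r+3.  Any 2r+3 vertices contain two with more than 2k+2r+2 common
-- neighbours: otherwise the Bonferroni inequality Σ|N(zᵢ)| ≤ n + Σ_{i<j} |N(zᵢ) ∩ N(zⱼ)|
-- together with |N(zᵢ)| ≥ n/(2r+2) gives n ≤ (2r+2)·C(2r+3,2)·(2k+2r+2) < 108(r+1)^r k.
-- For two such z, z' ∈ A the path z y … x z' is two vertices longer than P and its ends still
-- have at least 2r+3 common neighbours off it.  Repeating this until the path has 2k vertices,
-- a common neighbour of its ends closes a cycle of length 2k+1.
module Submission where

open import Defs
open import Data.Nat using (ℕ; zero; suc; _+_; _*_; _^_; _≤_; _<_; z≤n; s≤s; z<s; >-nonZero)
open import Data.Nat.Properties
open import Data.Nat.Divisibility using (_∣_; divides; ∣m+n∣m⇒∣n; m∣m*n)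
open import Data.Nat.ListAction using (sum)
open import Data.Nat.ListAction.Properties using (sum-++)
open import Data.Nat.Tactic.RingSolver using (solve-∀)
open import Data.Bool using (true; false)
open import Data.Fin using (Fin; zero; suc; fromℕ; inject₁; opposite)
open import Data.Fin.Properties using (any?; opposite-involutive) renaming (_≟_ to _≟ᶠ_; suc-injective to Fin-suc-injective)
open import Data.Fin.Subset using (Subset; ∣_∣; _∩_; _∪_; _─_; _∈_; _∉_; _⊆_; ⊥; ⋃; ⁅_⁆; Nonempty)
open import Data.Fin.Subset.Properties using (∩-distribˡ-∪; ∩-zeroʳ; ∣⊥∣≡0; ∣p∣≤n; ∣⁅x⁆∣≡1; p⊆q⇒∣p∣≤∣q∣; x∈p∪q⁺; x∈p∩q⁻; x∈p∧x∉q⇒x∈p─q; p─q⊆p; x∈⁅x⁆; _∈?_)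
open import Data.List using (List; []; _∷_; length; map; _++_)
open import Data.List.Properties using (length-map; length-++; map-++; map-∘)
open import Data.List.Relation.Unary.All as All using (All; []; _∷_)
open import Data.List.Relation.Unary.All.Properties as All using ()
open import Data.List.Relation.Unary.Any as Any using (Any; here; there)
open import Data.List.Relation.Unary.AllPairs using (AllPairs; []; _∷_)
open import Data.List.Relation.Unary.Unique.Propositional using (Unique)
import Data.List.Relation.Unary.Unique.Propositional.Properties as Unique
open import Data.Vec using (tabulate; []; _∷_; here; there)
open import Data.Vec.Properties using (lookup∘tabulate; []=⇒lookup; lookup⇒[]=)
open import Data.Vec.Functional using (reverse) renaming (_∷_ to _∷ᶠ_)
open import Data.Product using (∃₂; ∃-syntax; _×_; _,_; proj₁; proj₂)
open import Data.Sum using (inj₁; inj₂)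
open import Data.Empty using (⊥-elim)
open import Function using (_∘_; case_of_)
open import Relation.Nullary using (¬_; yes; no; does)
open import Relation.Nullary.Decidable using (dec-true)
open import Relation.Unary using (Pred; Decidable)
open import Relation.Binary using (Rel)
open import Relation.Binary.PropositionalEquality as ≡ using (_≡_; _≢_; refl; cong; cong₂; subst; module ≡-Reasoning)

∣p∪q∣+∣p∩q∣≡∣p∣+∣q∣ : ∀ {n} (p q : Subset n) → ∣ p ∪ q ∣ + ∣ p ∩ q ∣ ≡ ∣ p ∣ + ∣ q ∣
∣p∪q∣+∣p∩q∣≡∣p∣+∣q∣ []         []         = refl
∣p∪q∣+∣p∩q∣≡∣p∣+∣q∣ (true ∷ p) (true ∷ q) = cong suc (begin
  ∣ p ∪ q ∣ + suc ∣ p ∩ q ∣    ≡⟨ +-suc ∣ p ∪ q ∣ ∣ p ∩ q ∣ ⟩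
  suc (∣ p ∪ q ∣ + ∣ p ∩ q ∣)  ≡⟨ cong suc (∣p∪q∣+∣p∩q∣≡∣p∣+∣q∣ p q) ⟩
  suc (∣ p ∣ + ∣ q ∣)          ≡⟨ +-suc ∣ p ∣ ∣ q ∣ ⟨
  ∣ p ∣ + suc ∣ q ∣            ∎)
  where open ≡-Reasoning
∣p∪q∣+∣p∩q∣≡∣p∣+∣q∣ (true ∷ p)  (false ∷ q) = cong suc (∣p∪q∣+∣p∩q∣≡∣p∣+∣q∣ p q)
∣p∪q∣+∣p∩q∣≡∣p∣+∣q∣ (false ∷ p) (true ∷ q)  =
  ≡.trans (cong suc (∣p∪q∣+∣p∩q∣≡∣p∣+∣q∣ p q)) (≡.sym (+-suc ∣ p ∣ ∣ q ∣))
∣p∪q∣+∣p∩q∣≡∣p∣+∣q∣ (false ∷ p) (false ∷ q) = ∣p∪q∣+∣p∩q∣≡∣p∣+∣q∣ p q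

∣p∪q∣≤∣p∣+∣q∣ : ∀ {n} (p q : Subset n) → ∣ p ∪ q ∣ ≤ ∣ p ∣ + ∣ q ∣
∣p∪q∣≤∣p∣+∣q∣ p q = m+n≤o⇒m≤o ∣ p ∪ q ∣ (≤-reflexive (∣p∪q∣+∣p∩q∣≡∣p∣+∣q∣ p q))

∣p∣≤∣p─q∣+∣q∣ : ∀ {n} (p q : Subset n) → ∣ p ∣ ≤ ∣ p ─ q ∣ + ∣ q ∣
∣p∣≤∣p─q∣+∣q∣ p q = ≤-trans (p⊆q⇒∣p∣≤∣q∣ p⊆[p─q]∪q) (∣p∪q∣≤∣p∣+∣q∣ (p ─ q) q)
  where
  p⊆[p─q]∪q : p ⊆ (p ─ q) ∪ q
  p⊆[p─q]∪q {x} x∈p with x ∈? q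
  ... | yes x∈q = x∈p∪q⁺ (inj₂ x∈q)
  ... | no x∉q  = x∈p∪q⁺ (inj₁ (x∈p∧x∉q⇒x∈p─q x∈p x∉q))

∣p∩⋃F∣≤∑∣p∩F∣ : ∀ {a n} {A : Set a} (p : Subset n) (F : A → Subset n) (xs : List A) →
  ∣ p ∩ ⋃ (map F xs) ∣ ≤ sum (map (λ x → ∣ p ∩ F x ∣) xs)
∣p∩⋃F∣≤∑∣p∩F∣ {n = n} p F [] = ≤-reflexive (≡.trans (cong ∣_∣ (∩-zeroʳ p)) (∣⊥∣≡0 n))
∣p∩⋃F∣≤∑∣p∩F∣ p F (x ∷ xs) = begin
  ∣ p ∩ (F x ∪ U) ∣           ≡⟨ cong ∣_∣ (∩-distribˡ-∪ p (F x) U) ⟩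
  ∣ (p ∩ F x) ∪ (p ∩ U) ∣     ≤⟨ ∣p∪q∣≤∣p∣+∣q∣ (p ∩ F x) (p ∩ U) ⟩
  ∣ p ∩ F x ∣ + ∣ p ∩ U ∣     ≤⟨ +-monoʳ-≤ ∣ p ∩ F x ∣ (∣p∩⋃F∣≤∑∣p∩F∣ p F xs) ⟩
  ∣ p ∩ F x ∣ + sum (map (λ y → ∣ p ∩ F y ∣) xs) ∎
  where
  open ≤-Reasoning
  U = ⋃ (map F xs)

x∈p─q⇒x∉q : ∀ {n} {p q : Subset n} {x} → x ∈ p ─ q → x ∉ q
x∈p─q⇒x∉q {p = _ ∷ p} {true ∷ q}  ()   here
x∈p─q⇒x∉q {p = _ ∷ p} {false ∷ q} here ()
x∈p─q⇒x∉q {p = _ ∷ p} {_ ∷ q} (there x∈p─q) (there x∈q) = x∈p─q⇒x∉q x∈p─q x∈q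

∣p∣>0⇒Nonempty : ∀ {n} (p : Subset n) → 0 < ∣ p ∣ → Nonempty p
∣p∣>0⇒Nonempty (true ∷ p)  _ = zero , here
∣p∣>0⇒Nonempty (false ∷ p) ∣p∣>0 with ∣p∣>0⇒Nonempty p ∣p∣>0
... | x , x∈p = suc x , there x∈p

⊆image⇒∣p∣≤m : ∀ {n m} (f : Fin m → Fin n) (p : Subset n) → (∀ {x} → x ∈ p → ∃[ i ] f i ≡ x) → ∣ p ∣ ≤ m
⊆image⇒∣p∣≤m {n} {zero} f p covered =
  ≤-trans (p⊆q⇒∣p∣≤∣q∣ {q = ⊥} (λ x∈p → case covered x∈p of λ ())) (≤-reflexive (∣⊥∣≡0 n))
⊆image⇒∣p∣≤m {m = suc m} f p covered = begin
  ∣ p ∣                                ≤⟨ ∣p∣≤∣p─q∣+∣q∣ p ⁅ f zero ⁆ ⟩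
  ∣ p ─ ⁅ f zero ⁆ ∣ + ∣ ⁅ f zero ⁆ ∣  ≡⟨ cong (∣ p ─ ⁅ f zero ⁆ ∣ +_) (∣⁅x⁆∣≡1 (f zero)) ⟩
  ∣ p ─ ⁅ f zero ⁆ ∣ + 1               ≤⟨ +-monoˡ-≤ 1 (⊆image⇒∣p∣≤m (f ∘ suc) (p ─ ⁅ f zero ⁆) covered′) ⟩
  m + 1                                ≡⟨ +-comm m 1 ⟩
  suc m                                ∎
  where
  open ≤-Reasoning
  covered′ : ∀ {x} → x ∈ p ─ ⁅ f zero ⁆ → ∃[ i ] f (suc i) ≡ x
  covered′ x∈ with covered (p─q⊆p p _ x∈)
  ... | zero  , refl = ⊥-elim (x∈p─q⇒x∉q x∈ (x∈⁅x⁆ _))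
  ... | suc i , fi≡x = i , fi≡x

pickDistinct : ∀ {n} m (A : Subset n) → m ≤ ∣ A ∣ → ∃[ zs ] length zs ≡ m × Unique zs × All (_∈ A) zs
pickDistinct zero    A           _        = [] , refl , [] , []
pickDistinct (suc m) (true ∷ A)  (s≤s m≤) with pickDistinct m A m≤
... | zs , refl , unique , zs⊆A =
  zero ∷ map suc zs , cong suc (length-map suc zs) ,
  All.map⁺ (All.universal (λ _ ()) zs) ∷ Unique.map⁺ Fin-suc-injective unique ,
  here ∷ All.map⁺ (All.map there zs⊆A)
pickDistinct (suc m) (false ∷ A) m≤       with pickDistinct (suc m) A m≤
... | zs , length≡ , unique , zs⊆A =
  map suc zs , ≡.trans (length-map suc zs) length≡ ,
  Unique.map⁺ Fin-suc-injective unique , All.map⁺ (All.map there zs⊆A)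

module _ {n ℓ} {P : Pred (Fin n) ℓ} (P? : Decidable P) where

  ∈-tabulate-does⁺ : ∀ {x} → P x → x ∈ tabulate (does ∘ P?)
  ∈-tabulate-does⁺ {x} px = lookup⇒[]= x _ (≡.trans (lookup∘tabulate (does ∘ P?) x) (dec-true (P? x) px))

  ∈-tabulate-does⁻ : ∀ {x} → x ∈ tabulate (does ∘ P?) → P x
  ∈-tabulate-does⁻ {x} x∈ with P? x | ≡.trans (≡.sym (lookup∘tabulate (does ∘ P?) x)) ([]=⇒lookup x∈)
  ... | yes px | _ = px
  ... | no _   | ()

module _ {a} {A : Set a} where

  pairs : List A → List (A × A)
  pairs []       = []
  pairs (x ∷ xs) = map (x ,_) xs ++ pairs xs

  All-pairs⁺ : ∀ {p r} {P : Pred A p} {R : Rel A r} {xs} → All P xs → AllPairs R xs →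
    All (λ (xy : A × A) → P (proj₁ xy) × P (proj₂ xy) × R (proj₁ xy) (proj₂ xy)) (pairs xs)
  All-pairs⁺ []         []         = []
  All-pairs⁺ (px ∷ pxs) (rx ∷ rxs) =
    All.++⁺ (All.map⁺ (All.zipWith (λ (py , rxy) → px , py , rxy) (pxs , rx))) (All-pairs⁺ pxs rxs)

  overlapSize : ∀ {n} → (A → Subset n) → A × A → ℕ
  overlapSize F (x , y) = ∣ F x ∩ F y ∣

  bonferroni : ∀ {n} (F : A → Subset n) (xs : List A) →
    sum (map (∣_∣ ∘ F) xs) ≤ ∣ ⋃ (map F xs) ∣ + sum (map (overlapSize F) (pairs xs))
  bonferroni F []       = z≤n
  bonferroni F (x ∷ xs) = begin
    ∣ F x ∣ + sum (map (∣_∣ ∘ F) xs)    ≤⟨ +-monoʳ-≤ ∣ F x ∣ (bonferroni F xs) ⟩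
    ∣ F x ∣ + (∣ U ∣ + S)               ≡⟨ +-assoc ∣ F x ∣ ∣ U ∣ S ⟨
    ∣ F x ∣ + ∣ U ∣ + S                 ≡⟨ cong (_+ S) (∣p∪q∣+∣p∩q∣≡∣p∣+∣q∣ (F x) U) ⟨
    ∣ F x ∪ U ∣ + ∣ F x ∩ U ∣ + S       ≤⟨ +-monoˡ-≤ S (+-monoʳ-≤ ∣ F x ∪ U ∣ (∣p∩⋃F∣≤∑∣p∩F∣ (F x) F xs)) ⟩
    ∣ F x ∪ U ∣ + Sₓ + S                ≡⟨ +-assoc ∣ F x ∪ U ∣ Sₓ S ⟩
    ∣ F x ∪ U ∣ + (Sₓ + S)              ≡⟨ cong (∣ F x ∪ U ∣ +_) overlaps-cons ⟨
    ∣ F x ∪ U ∣ + sum (map (overlapSize F) (pairs (x ∷ xs))) ∎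
    where
    open ≤-Reasoning
    U  = ⋃ (map F xs)
    S  = sum (map (overlapSize F) (pairs xs))
    Sₓ = sum (map (λ y → ∣ F x ∩ F y ∣) xs)
    overlaps-cons : sum (map (overlapSize F) (map (x ,_) xs ++ pairs xs)) ≡ Sₓ + S
    overlaps-cons = begin-equality
      sum (map (overlapSize F) (map (x ,_) xs ++ pairs xs))
        ≡⟨ cong sum (map-++ (overlapSize F) (map (x ,_) xs) (pairs xs)) ⟩
      sum (map (overlapSize F) (map (x ,_) xs) ++ map (overlapSize F) (pairs xs))
        ≡⟨ sum-++ (map (overlapSize F) (map (x ,_) xs)) _ ⟩
      sum (map (overlapSize F) (map (x ,_) xs)) + S
        ≡⟨ cong (λ ys → sum ys + S) (map-∘ xs) ⟨
      Sₓ + S ∎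

  sum>length*L⇒Any : ∀ (g : A → ℕ) L xs → length xs * L < sum (map g xs) → Any (λ x → L < g x) xs
  sum>length*L⇒Any g L (x ∷ xs) bound with L <? g x
  ... | yes L<gx = here L<gx
  ... | no L≮gx  = there (sum>length*L⇒Any g L xs (+-cancelˡ-< L _ _
                     (<-≤-trans bound (+-monoˡ-≤ (sum (map g xs)) (≮⇒≥ L≮gx)))))

  length*≤*sum : ∀ {m} c (g : A → ℕ) → (∀ x → m ≤ c * g x) → ∀ xs → length xs * m ≤ c * sum (map g xs)
  length*≤*sum c g bound []       = z≤n
  length*≤*sum c g bound (x ∷ xs) =
    ≤-trans (+-mono-≤ (bound x) (length*≤*sum c g bound xs)) (≤-reflexive (≡.sym (*-distribˡ-+ c (g x) _)))

pairCount : ℕ → ℕ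
pairCount zero    = 0
pairCount (suc l) = l + pairCount l

length-pairs : ∀ {a} {A : Set a} (xs : List A) → length (pairs xs) ≡ pairCount (length xs)
length-pairs []       = refl
length-pairs (x ∷ xs) =
  ≡.trans (length-++ (map (x ,_) xs)) (cong₂ _+_ (length-map (x ,_) xs) (length-pairs xs))

2*pairCount+l≡l*l : ∀ l → 2 * pairCount l + l ≡ l * l
2*pairCount+l≡l*l zero    = refl
2*pairCount+l≡l*l (suc l) = begin
  2 * (l + pairCount l) + suc l      ≡⟨ regroup l (pairCount l) ⟩
  2 * pairCount l + l + (2 * l + 1)  ≡⟨ cong (_+ (2 * l + 1)) (2*pairCount+l≡l*l l) ⟩
  l * l + (2 * l + 1)                ≡⟨ square l ⟩
  suc l * suc l                      ∎
  where
  open ≡-Reasoning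
  regroup : ∀ l c → 2 * (l + c) + suc l ≡ 2 * c + l + (2 * l + 1)
  regroup = solve-∀
  square : ∀ l → l * l + (2 * l + 1) ≡ suc l * suc l
  square = solve-∀

opposite-inject₁ : ∀ {m} (i : Fin m) → opposite (inject₁ i) ≡ suc (opposite i)
opposite-inject₁ {suc m} zero    = refl
opposite-inject₁ {suc m} (suc i) = cong inject₁ (opposite-inject₁ i)

opposite-fromℕ : ∀ m → opposite (fromℕ m) ≡ zero
opposite-fromℕ zero    = refl
opposite-fromℕ (suc m) = cong inject₁ (opposite-fromℕ m)

module _ {n : ℕ} (G : Graph n) where

  ∈N⁻ : ∀ {v u} → u ∈ N G v → Adj G v u
  ∈N⁻ {v} = ∈-tabulate-does⁻ (adj? G v)

  ∈vertexSet⁺ : ∀ {m} (p : Fin m → Fin n) i → p i ∈ vertexSet p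
  ∈vertexSet⁺ p i = ∈-tabulate-does⁺ (λ v → any? (λ j → p j ≟ᶠ v)) (i , refl)

  ∣vertexSet∣≤m : ∀ {m} (p : Fin m → Fin n) → ∣ vertexSet p ∣ ≤ m
  ∣vertexSet∣≤m p = ⊆image⇒∣p∣≤m p (vertexSet p) (∈-tabulate-does⁻ (λ v → any? (λ j → p j ≟ᶠ v)))

  consPath : ∀ {m} {q : Fin (suc m) → Fin n} {w} →
    IsPath G m q → Adj G w (q zero) → (∀ i → q i ≢ w) → IsPath G (suc m) (w ∷ᶠ q)
  consPath {q = q} {w} (q-injective , q-adjacent) w~q₀ w∉q = injective , adjacent
    where
    injective : ∀ {i j} → (w ∷ᶠ q) i ≡ (w ∷ᶠ q) j → i ≡ j
    injective {zero}  {zero}  _  = refl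
    injective {zero}  {suc j} eq = ⊥-elim (w∉q j (≡.sym eq))
    injective {suc i} {zero}  eq = ⊥-elim (w∉q i eq)
    injective {suc i} {suc j} eq = cong suc (q-injective eq)
    adjacent : ∀ i → Adj G ((w ∷ᶠ q) (inject₁ i)) ((w ∷ᶠ q) (suc i))
    adjacent zero    = w~q₀
    adjacent (suc i) = q-adjacent i

  reversePath : ∀ {m} {q : Fin (suc m) → Fin n} → IsPath G m q → IsPath G m (reverse q)
  reversePath {q = q} (q-injective , q-adjacent) = injective , adjacent
    where
    injective : ∀ {i j} → reverse q i ≡ reverse q j → i ≡ j
    injective {i} {j} eq = begin
      i                      ≡⟨ opposite-involutive i ⟨
      opposite (opposite i)  ≡⟨ cong opposite (q-injective eq) ⟩
      opposite (opposite j)  ≡⟨ opposite-involutive j ⟩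
      j                      ∎
      where open ≡-Reasoning
    adjacent : ∀ i → Adj G (reverse q (inject₁ i)) (reverse q (suc i))
    adjacent i rewrite opposite-inject₁ i = sym G (q-adjacent (opposite i))

  commonExternalNeighbours : ∀ {m} → (Fin (suc m) → Fin n) → Subset n
  commonExternalNeighbours {m} q = (N G (q zero) ∩ N G (q (fromℕ m))) ─ vertexSet q

  ∈commonExternalNeighbours⁻ : ∀ {m} (q : Fin (suc m) → Fin n) {u} → u ∈ commonExternalNeighbours q →
    Adj G (q zero) u × Adj G (q (fromℕ m)) u × (∀ i → q i ≢ u)
  ∈commonExternalNeighbours⁻ {m} q u∈
    with x∈p∩q⁻ (N G (q zero)) (N G (q (fromℕ m))) (p─q⊆p _ (vertexSet q) u∈)
  ... | u∈N₀ , u∈Nₘ = ∈N⁻ u∈N₀ , ∈N⁻ u∈Nₘ , λ { i refl → x∈p─q⇒x∉q u∈ (∈vertexSet⁺ q i) }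

  closeCycle : ∀ {m} {q : Fin (suc m) → Fin n} {u} →
    IsPath G m q → u ∈ commonExternalNeighbours q → HasCycleOfLength G (suc (suc m))
  closeCycle {q = q} {u} path u∈ =
    let q₀~u , qₘ~u , u∉q = ∈commonExternalNeighbours⁻ q u∈
    in u ∷ᶠ q , consPath path (sym G q₀~u) u∉q , qₘ~u

  bridge : ∀ {m} → Fin n → Fin n → (Fin (suc m) → Fin n) → Fin (suc (suc (suc m))) → Fin n
  bridge z z′ q = z ∷ᶠ reverse (z′ ∷ᶠ q)

  bridge-last : ∀ {m} z z′ (q : Fin (suc m) → Fin n) → bridge z z′ q (fromℕ (suc (suc m))) ≡ z′
  bridge-last z z′ q = cong (z′ ∷ᶠ q) (opposite-fromℕ _)

  bridgePath : ∀ {m} {q : Fin (suc m) → Fin n} {z z′} → IsPath G m q →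
    z ∈ commonExternalNeighbours q → z′ ∈ commonExternalNeighbours q → z ≢ z′ →
    IsPath G (suc (suc m)) (bridge z z′ q)
  bridgePath {q = q} {z} {z′} path z∈ z′∈ z≢z′
    with ∈commonExternalNeighbours⁻ q z∈ | ∈commonExternalNeighbours⁻ q z′∈
  ... | _ , qₘ~z , z∉q | q₀~z′ , _ , z′∉q =
    consPath (reversePath (consPath path (sym G q₀~z′) z′∉q)) (sym G qₘ~z) z∉z′q
    where
    z∉z′q : ∀ i → (z′ ∷ᶠ q) (opposite i) ≢ z
    z∉z′q i with opposite i
    ... | zero  = z≢z′ ∘ ≡.sym
    ... | suc j = z∉q j

  ∣N∩N∣≤∣commonExternalNeighbours[bridge]∣+m+3 : ∀ {m} (q : Fin (suc m) → Fin n) z z′ →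
    ∣ N G z ∩ N G z′ ∣ ≤ ∣ commonExternalNeighbours (bridge z z′ q) ∣ + suc (suc (suc m))
  ∣N∩N∣≤∣commonExternalNeighbours[bridge]∣+m+3 q z z′ = begin
    ∣ N G z ∩ N G z′ ∣                              ≤⟨ ∣p∣≤∣p─q∣+∣q∣ (N G z ∩ N G z′) V ⟩
    ∣ (N G z ∩ N G z′) ─ V ∣ + ∣ V ∣                 ≡⟨ cong (λ w → ∣ (N G z ∩ N G w) ─ V ∣ + ∣ V ∣) (bridge-last z z′ q) ⟨
    ∣ commonExternalNeighbours (bridge z z′ q) ∣ + ∣ V ∣ ≤⟨ +-monoʳ-≤ _ (∣vertexSet∣≤m (bridge z z′ q)) ⟩
    ∣ commonExternalNeighbours (bridge z z′ q) ∣ + _     ∎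
    where
    open ≤-Reasoning
    V = vertexSet (bridge z z′ q)

  HeavyPairIn : ℕ → Subset n → Set
  HeavyPairIn L A = ∃₂ λ u v → (u ∈ A × v ∈ A × u ≢ v) × L < ∣ N G u ∩ N G v ∣

  oddCycle : ∀ k c → (∀ A → suc c ≤ ∣ A ∣ → HeavyPairIn (2 * k + c) A) →
    ∀ j {m} {q : Fin (suc m) → Fin n} → suc m + 2 * j ≡ 2 * k → IsPath G m q →
    suc c ≤ ∣ commonExternalNeighbours q ∣ → HasCycleOfLength G (2 * k + 1)
  oddCycle k c heavy zero {m} length≡ path large =
    subst (HasCycleOfLength G) m+2≡2k+1 (closeCycle path (proj₂ (∣p∣>0⇒Nonempty _ (≤-trans (s≤s z≤n) large))))
    where
    m+2≡2k+1 : suc (suc m) ≡ 2 * k + 1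
    m+2≡2k+1 = ≡.trans (cong suc (≡.trans (≡.sym (+-identityʳ (suc m))) length≡)) (+-comm 1 (2 * k))
  oddCycle k c heavy (suc j) {m} {q} length≡ path large with heavy _ large
  ... | z , z′ , (z∈ , z′∈ , z≢z′) , z,z′-heavy =
    oddCycle k c heavy j length≡′ (bridgePath path z∈ z′∈ z≢z′) large′
    where
    length≡′ : suc (suc (suc m)) + 2 * j ≡ 2 * k
    length≡′ = ≡.trans (shift m j) length≡
      where
      shift : ∀ m j → 3 + m + 2 * j ≡ suc m + 2 * suc j
      shift = solve-∀
    A′ = commonExternalNeighbours (bridge z z′ q)
    large′ : suc c ≤ ∣ A′ ∣
    large′ = +-cancelˡ-≤ (2 * k) (suc c) ∣ A′ ∣ (begin
      2 * k + suc c               ≡⟨ +-suc (2 * k) c ⟩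
      suc (2 * k + c)             ≤⟨ z,z′-heavy ⟩
      ∣ N G z ∩ N G z′ ∣          ≤⟨ ∣N∩N∣≤∣commonExternalNeighbours[bridge]∣+m+3 q z z′ ⟩
      ∣ A′ ∣ + suc (suc (suc m))  ≤⟨ +-monoʳ-≤ ∣ A′ ∣ (≤-trans (m≤m+n _ (2 * j)) (≤-reflexive length≡′)) ⟩
      ∣ A′ ∣ + 2 * k              ≡⟨ +-comm ∣ A′ ∣ (2 * k) ⟩
      2 * k + ∣ A′ ∣              ∎)
      where open ≤-Reasoning

  module _ {c : ℕ} (minDegree : ∀ v → n ≤ c * degree G v) where

    someHeavyPair : ∀ L (zs : List (Fin n)) → length zs ≡ suc c → c * (pairCount (suc c) * L) < n →
      Any (λ uv → L < overlapSize (N G) uv) (pairs zs)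
    someHeavyPair L zs length≡ sparse =
      sum>length*L⇒Any (overlapSize (N G)) L (pairs zs) (*-cancelˡ-< c _ _ (<-≤-trans c*P*L<n n≤c*S))
      where
      S = sum (map (overlapSize (N G)) (pairs zs))
      c*P*L<n : c * (length (pairs zs) * L) < n
      c*P*L<n = subst (λ l → c * (l * L) < n) (≡.sym (≡.trans (length-pairs zs) (cong pairCount length≡))) sparse
      n≤c*S : n ≤ c * S
      n≤c*S = +-cancelʳ-≤ (c * n) n (c * S) (begin
        n + c * n                       ≡⟨ cong (_* n) length≡ ⟨
        length zs * n                   ≤⟨ length*≤*sum c (degree G) minDegree zs ⟩
        c * sum (map (degree G) zs)     ≤⟨ *-monoʳ-≤ c (bonferroni (N G) zs) ⟩
        c * (∣ ⋃ (map (N G) zs) ∣ + S)  ≤⟨ *-monoʳ-≤ c (+-monoˡ-≤ S (∣p∣≤n (⋃ (map (N G) zs)))) ⟩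
        c * (n + S)                     ≡⟨ *-distribˡ-+ c n S ⟩
        c * n + c * S                   ≡⟨ +-comm (c * n) (c * S) ⟩
        c * S + c * n                   ∎)
        where open ≤-Reasoning

    heavyPairIn : ∀ L → c * (pairCount (suc c) * L) < n → ∀ A → suc c ≤ ∣ A ∣ → HeavyPairIn L A
    heavyPairIn L sparse A large with pickDistinct (suc c) A large
    ... | zs , length≡ , unique , zs⊆A =
      let hit = someHeavyPair L zs length≡ sparse
      in proj₁ (Any.lookup hit) , proj₂ (Any.lookup hit) , All.lookupAny (All-pairs⁺ zs⊆A unique) hit

pairCount[2r+3] : ∀ r → pairCount (suc (2 * r + 2)) ≡ (2 * r + 3) * (r + 1)
pairCount[2r+3] r = *-cancelˡ-≡ _ _ 2 (+-cancelʳ-≡ l _ _ (≡.trans (2*pairCount+l≡l*l l) (closedForm r)))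
  where
  l = suc (2 * r + 2)
  closedForm : ∀ r → suc (2 * r + 2) * suc (2 * r + 2) ≡ 2 * ((2 * r + 3) * (r + 1)) + suc (2 * r + 2)
  closedForm = solve-∀

r<f : ∀ r → r < f r
r<f 0 = s≤s z≤n
r<f 1 = s≤s (s≤s z≤n)
r<f 2 = s≤s (s≤s (s≤s z≤n))
r<f r@(suc (suc (suc _))) = ≤-<-trans (m≤m+n r (2 * r)) (m<m+n (3 * r) z<s)

8*[2r+3]*[r+1]*[r+1]<108*[r+1]^r : ∀ {r} → 2 ≤ r → 8 * (2 * r + 3) * ((r + 1) * (r + 1)) < 108 * (r + 1) ^ r
8*[2r+3]*[r+1]*[r+1]<108*[r+1]^r {1} (s≤s ())
8*[2r+3]*[r+1]*[r+1]<108*[r+1]^r {2} _ = m<m+n 504 {468} z<s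
8*[2r+3]*[r+1]*[r+1]<108*[r+1]^r {r@(suc (suc (suc _)))} _ = begin-strict
  8 * (2 * r + 3) * ((r + 1) * (r + 1))  <⟨ *-monoˡ-< ((r + 1) * (r + 1)) linear ⟩
  108 * (r + 1) * ((r + 1) * (r + 1))    ≡⟨ cube ⟩
  108 * (r + 1) ^ 3                      ≤⟨ *-monoʳ-≤ 108 (^-monoʳ-≤ (r + 1) {3} {r} (s≤s (s≤s (s≤s z≤n)))) ⟩
  108 * (r + 1) ^ r                      ∎
  where
  open ≤-Reasoning
  slack : ∀ r → 8 * (2 * r + 3) + (92 * r + 84) ≡ 108 * (r + 1)
  slack = solve-∀
  linear : 8 * (2 * r + 3) < 108 * (r + 1)
  linear = <-≤-trans (m<m+n (8 * (2 * r + 3)) z<s) (≤-reflexive (slack r))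
  cube : 108 * (r + 1) * ((r + 1) * (r + 1)) ≡ 108 * (r + 1) ^ 3
  cube = ≡.trans (cong (λ x → 108 * (r + 1) * ((r + 1) * x)) (≡.sym (*-identityʳ (r + 1))))
                 (*-assoc 108 (r + 1) ((r + 1) ^ 2))

countingBound : ∀ {r k} → 2 ≤ r → f r ≤ k →
  (2 * r + 2) * (pairCount (suc (2 * r + 2)) * (2 * k + (2 * r + 2))) < 108 * (r + 1) ^ r * k
countingBound {r} {k} 2≤r f≤k = begin-strict
  (2 * r + 2) * (pairCount (suc (2 * r + 2)) * (2 * k + (2 * r + 2)))
    ≡⟨ cong (λ P → (2 * r + 2) * (P * (2 * k + (2 * r + 2)))) (pairCount[2r+3] r) ⟩
  (2 * r + 2) * ((2 * r + 3) * (r + 1) * (2 * k + (2 * r + 2)))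
    ≡⟨ regroup r k ⟩
  4 * (2 * r + 3) * ((r + 1) * (r + 1)) * (k + (r + 1))
    ≤⟨ *-monoʳ-≤ (4 * (2 * r + 3) * ((r + 1) * (r + 1))) (+-monoʳ-≤ k r+1≤k) ⟩
  4 * (2 * r + 3) * ((r + 1) * (r + 1)) * (k + k)
    ≡⟨ double r k ⟩
  8 * (2 * r + 3) * ((r + 1) * (r + 1)) * k
    <⟨ *-monoˡ-< k {{>-nonZero (≤-<-trans z≤n r<k)}} (8*[2r+3]*[r+1]*[r+1]<108*[r+1]^r 2≤r) ⟩
  108 * (r + 1) ^ r * k ∎
  where
  open ≤-Reasoning
  r<k : r < k
  r<k = <-≤-trans (r<f r) f≤k
  r+1≤k : r + 1 ≤ k
  r+1≤k = ≤-trans (≤-reflexive (+-comm r 1)) r<k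
  regroup : ∀ r k → (2 * r + 2) * ((2 * r + 3) * (r + 1) * (2 * k + (2 * r + 2)))
                  ≡ 4 * (2 * r + 3) * ((r + 1) * (r + 1)) * (k + (r + 1))
  regroup = solve-∀
  double : ∀ r k → 4 * (2 * r + 3) * ((r + 1) * (r + 1)) * (k + k) ≡ 8 * (2 * r + 3) * ((r + 1) * (r + 1)) * k
  double = solve-∀

2r+2≤15r : ∀ {r} → 1 ≤ r → 2 * r + 2 ≤ 15 * r
2r+2≤15r {suc s} _ = ≤-trans (m≤m+n (2 * suc s + 2) (13 * s + 11)) (≤-reflexive (slack s))
  where
  slack : ∀ s → 2 * suc s + 2 + (13 * s + 11) ≡ 15 * suc s
  slack = solve-∀

even-gap : ∀ {a b} → 2 ∣ a → 2 ∣ b → a ≤ b → ∃[ j ] a + 2 * j ≡ b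
even-gap {a} 2∣a 2∣b a≤b with m≤n⇒∃[o]m+o≡n a≤b
... | o , a+o≡b with ∣m+n∣m⇒∣n (subst (2 ∣_) (≡.sym a+o≡b) 2∣b) 2∣a
... | divides j o≡j*2 = j , ≡.trans (cong (a +_) (≡.trans (*-comm 2 j) (≡.sym o≡j*2))) a+o≡b

lemma3p1 : (r k n : ℕ) → 2 ≤ r → 108 * (r + 1) ^ r * k ≤ n → f r ≤ k →
    (G : Graph n) → ¬ HasCycleOfLength G (2 * k + 1) →
    (∀ (v : Fin n) → n ≤ (2 * r + 2) * degree G v) →
    (m : ℕ) (p : Fin (suc m) → Fin n) → IsPath G m p → 2 ∣ suc m → suc m ≤ 2 * k →
    ∣ (N G (p zero) ∩ N G (p (fromℕ m))) ─ vertexSet p ∣ ≤ 15 * r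
lemma3p1 r k n 2≤r large f≤k G noCycle minDegree m p path even short
  with ∣ commonExternalNeighbours G p ∣ ≤? 15 * r
... | yes bounded  = bounded
... | no unbounded =
  let j , length≡ = even-gap even (m∣m*n k) short
  in ⊥-elim (noCycle (oddCycle G k (2 * r + 2) heavy j length≡ path 2r+3≤∣A∣))
  where
  heavy : ∀ A → suc (2 * r + 2) ≤ ∣ A ∣ → HeavyPairIn G (2 * k + (2 * r + 2)) A
  heavy = heavyPairIn G minDegree _ (<-≤-trans (countingBound 2≤r f≤k) large)
  2r+3≤∣A∣ : suc (2 * r + 2) ≤ ∣ commonExternalNeighbours G p ∣
  2r+3≤∣A∣ = ≤-trans (s≤s (2r+2≤15r (≤-trans (s≤s z≤n) 2≤r))) (≰⇒> unbounded)
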